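{- Let $n\ge 2$, let $P_n$ be the path on $n$ vertices, and let $H$ be an arbitrary connected graph. Then \[F(P_n+_S H)=nF(H)+6(n-1)M_1(H)+12(2n-3)|E(H)|+2(8n-11)|V(H)|.\]
   Context: All graphs are finite, simple and undirected; $d_G(v)$ denotes degree. $F(G)=\sum_{v\in V(G)}d_G(v)^3$ and $M_1(G)=\sum_{v\in V(G)}d_G(v)^2$. The subdivision graph $S(G)$ is obtained from $G$ by replacing each edge by a path of length two; its vertex set is $V(G)\cup E(G)$. The $S$-sum $G+_S H$ is the graph with vertex set $(V(G)\cup E(G))\times V(H)$ in which $(u,v)$ and $(u',v')$ are adjacent if and only if [$u=u'\in V(G)$ and $vv'\in E(H)$] or [$v=v'$ and $uu'\in E(S(G))$]. -}

module Defs where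

open import Data.Bool using (Bool; true; false; _∧_; _∨_; T)
open import Data.Nat using (ℕ; zero; suc; _+_; _*_; _^_; _<ᵇ_; _≡ᵇ_)
open import Data.Fin using (Fin; toℕ; _≟_)
open import Data.List using (List; []; _∷_; allFin; cartesianProduct; mapMaybe; map)
open import Data.Nat.ListAction using (sum)
open import Data.Bool.Properties using (∨-comm)
open import Data.Maybe using (Maybe; just; nothing)
import Data.Maybe as Maybe
open import Data.Product using (Σ; _×_; _,_; proj₁; proj₂)
open import Data.Sum using (_⊎_; inj₁; inj₂)
open import Data.Unit using (tt)
open import Relation.Nullary.Decidable using (⌊_⌋)
open import Relation.Binary.PropositionalEquality using (_≡_; refl)

record SimpleGraph (n : ℕ) : Set where
  field
    adj    : Fin n → Fin n → Bool
    sym    : ∀ u v → adj u v ≡ adj v u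
    irrefl : ∀ v → adj v v ≡ false
open SimpleGraph public

count : {A : Set} → (A → Bool) → List A → ℕ
count p []       = 0
count p (x ∷ xs) with p x
... | true  = suc (count p xs)
... | false = count p xs

-- A finite graph given by an explicit duplicate-free list of its
-- vertices (used for S(G) and G +_S H, whose vertex sets are not Fin k).

record ListedGraph : Set₁ where
  field
    Vtx   : Set
    verts : List Vtx
    ladj  : Vtx → Vtx → Bool
open ListedGraph public

degL : (G : ListedGraph) → Vtx G → ℕ
degL G v = count (ladj G v) (verts G)

FL : ListedGraph → ℕ
FL G = sum (map (λ v → degL G v ^ 3) (verts G))

deg : ∀ {n} → SimpleGraph n → Fin n → ℕ
deg {n} G v = count (adj G v) (allFin n)

F : ∀ {n} → SimpleGraph n → ℕ
F {n} G = sum (map (λ v → deg G v ^ 3) (allFin n))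

M₁ : ∀ {n} → SimpleGraph n → ℕ
M₁ {n} G = sum (map (λ v → deg G v ^ 2) (allFin n))

-- an edge {i,j} is represented by the ordered pair (i , j) with i < j
isEdge : ∀ {n} → SimpleGraph n → Fin n × Fin n → Bool
isEdge G (i , j) = (toℕ i <ᵇ toℕ j) ∧ adj G i j

Edge : ∀ {n} → SimpleGraph n → Set
Edge {n} G = Σ (Fin n × Fin n) (λ p → T (isEdge G p))

withProof : (b : Bool) → Maybe (T b)
withProof true  = just tt
withProof false = nothing

edgeList : ∀ {n} → (G : SimpleGraph n) → List (Edge G)
edgeList {n} G =
  mapMaybe (λ p → Maybe.map (p ,_) (withProof (isEdge G p)))
           (cartesianProduct (allFin n) (allFin n))

numEdges : ∀ {n} → SimpleGraph n → ℕ
numEdges {n} G = count (isEdge G) (cartesianProduct (allFin n) (allFin n))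

data Reach {n} (G : SimpleGraph n) : Fin n → Fin n → Set where
  here : ∀ {v} → Reach G v v
  step : ∀ {u w v} → adj G u w ≡ true → Reach G w v → Reach G u v

Connected : ∀ {n} → SimpleGraph n → Set
Connected {n} G = (u v : Fin n) → Reach G u v

pathAdj : ∀ {n} → Fin n → Fin n → Bool
pathAdj i j = (suc (toℕ i) ≡ᵇ toℕ j) ∨ (suc (toℕ j) ≡ᵇ toℕ i)

private
  suc≢ᵇ : ∀ k → (suc k ≡ᵇ k) ≡ false
  suc≢ᵇ zero    = refl
  suc≢ᵇ (suc k) = suc≢ᵇ k

Path : (n : ℕ) → SimpleGraph n
Path n = record
  { adj    = pathAdj
  ; sym    = λ i j → ∨-comm (suc (toℕ i) ≡ᵇ toℕ j) (suc (toℕ j) ≡ᵇ toℕ i)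
  ; irrefl = λ v → irr (toℕ v) }
  where
  irr : ∀ k → ((suc k ≡ᵇ k) ∨ (suc k ≡ᵇ k)) ≡ false
  irr k rewrite suc≢ᵇ k = refl

SVtx : ∀ {n} → SimpleGraph n → Set
SVtx {n} G = Fin n ⊎ Edge G

eqᶠ : ∀ {n} → Fin n → Fin n → Bool
eqᶠ i j = ⌊ i ≟ j ⌋

incident : ∀ {n} {G : SimpleGraph n} → Fin n → Edge G → Bool
incident u ((i , j) , _) = eqᶠ u i ∨ eqᶠ u j

adjS : ∀ {n} (G : SimpleGraph n) → SVtx G → SVtx G → Bool
adjS G (inj₁ u) (inj₂ e) = incident {G = G} u e
adjS G (inj₂ e) (inj₁ u) = incident {G = G} u e
adjS G _        _        = false

Subdivision : ∀ {n} → SimpleGraph n → ListedGraph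
Subdivision {n} G = record
  { Vtx   = SVtx G
  ; verts = map inj₁ (allFin n) Data.List.++ map inj₂ (edgeList G)
  ; ladj  = adjS G }

sameOrigVertex : ∀ {n} {G : SimpleGraph n} → SVtx G → SVtx G → Bool
sameOrigVertex (inj₁ u) (inj₁ u') = eqᶠ u u'
sameOrigVertex _        _         = false

SSum : ∀ {n m} → SimpleGraph n → SimpleGraph m → ListedGraph
SSum {n} {m} G H = record
  { Vtx   = SVtx G × Fin m
  ; verts = cartesianProduct (verts (Subdivision G)) (allFin m)
  ; ladj  = λ { (u , v) (u' , v') →
                 (sameOrigVertex {G = G} u u' ∧ adj H v v')
               ∨ (eqᶠ v v' ∧ adjS G u u') } }

-- In G +_S H a vertex (u , v) with u ∈ V(G) has degree d_H(v) + d_G(u), and a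
-- vertex (e , v) with e ∈ E(G) has degree 2.  Expanding (d_H(v) + d_G(u))³ and
-- summing with the handshake lemma Σ d = 2|E| gives, for arbitrary G and H,
--   F(G +_S H) = |V(G)| F(H) + 6|E(G)| M₁(H) + 6 M₁(G) |E(H)| + |V(H)| F(G) + 8 |E(G)| |V(H)|.
-- The path P_n has two vertices of degree 1 and n − 2 of degree 2, so
-- |E(P_n)| = n − 1, M₁(P_n) = 4n − 6 and F(P_n) = 8n − 14.
module Submission where

open import Defs hiding (sym)
open import Data.Nat using (ℕ; zero; suc; _+_; _*_; _∸_; _^_; _≤_; _<_; _<ᵇ_; _≡ᵇ_; z≤n; s≤s)
open import Data.Nat.Properties
  using (+-identityʳ; *-identityʳ; *-zeroʳ; *-comm; *-distribˡ-+; *-cancelˡ-≡; m+n∸m≡n;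
         <-cmp; <⇒≤; ≤-refl; <⇒<ᵇ; m≢1+n+m; ≡ᵇ⇒≡; +-commutativeSemigroup)
open import Algebra.Properties.CommutativeSemigroup +-commutativeSemigroup
  using () renaming (interchange to +-interchange)
open import Data.Nat.ListAction using (sum)
open import Data.Nat.ListAction.Properties using (sum-++)
open import Data.Nat.Tactic.RingSolver using (solve-∀)
open import Data.Bool using (Bool; true; false; _∧_; _∨_; T)
open import Data.Bool.Properties using (∧-zeroʳ; ∨-identityʳ; T-≡)
open import Data.Fin using (Fin; zero; suc; toℕ; _≟_)
open import Data.Fin.Properties using (toℕ-injective; suc-injective; toℕ<n)
open import Data.List
  using (List; []; _∷_; _++_; [_]; map; length; tabulate; allFin; applyUpTo; cartesianProduct; mapMaybe)
open import Data.List.Properties using (map-cong; map-++; map-∘; map-tabulate; length-tabulate; applyUpTo-∷ʳ)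
open import Data.Maybe using (Maybe; just; nothing; maybe)
import Data.Maybe as Maybe
open import Data.Product using (_×_; _,_; proj₁; proj₂)
open import Data.Sum using (inj₁; inj₂)
open import Data.Unit using (tt)
open import Data.Empty using (⊥; ⊥-elim)
open import Function using (_∘_; id; mk⇔; Equivalence)
open import Relation.Binary.Definitions using (tri<; tri≈; tri>)
open import Relation.Binary.PropositionalEquality
  using (_≡_; _≢_; refl; sym; trans; cong; cong₂; subst; module ≡-Reasoning)
open import Relation.Nullary.Decidable using (isYes≗does; does-⇔; ⌊⌋-map′; toWitness)
open ≡-Reasoning

private
  variable
    A B : Set

𝟙 : Bool → ℕ
𝟙 true  = 1
𝟙 false = 0

𝟙-∧ : ∀ a b → 𝟙 (a ∧ b) ≡ 𝟙 a * 𝟙 b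
𝟙-∧ true  b = sym (+-identityʳ (𝟙 b))
𝟙-∧ false b = refl

𝟙-∨ : ∀ a b → (T a → T b → ⊥) → 𝟙 (a ∨ b) ≡ 𝟙 a + 𝟙 b
𝟙-∨ false _     _        = refl
𝟙-∨ true  false _        = refl
𝟙-∨ true  true  disjoint = ⊥-elim (disjoint tt tt)

<⇒<ᵇ≡true : ∀ {m n} → m < n → (m <ᵇ n) ≡ true
<⇒<ᵇ≡true m<n = Equivalence.to T-≡ (<⇒<ᵇ m<n)

≥⇒<ᵇ≡false : ∀ {m n} → n ≤ m → (m <ᵇ n) ≡ false
≥⇒<ᵇ≡false z≤n       = refl
≥⇒<ᵇ≡false (s≤s n≤m) = ≥⇒<ᵇ≡false n≤m

≡ᵇ-comm : ∀ m n → (m ≡ᵇ n) ≡ (n ≡ᵇ m)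
≡ᵇ-comm zero    zero    = refl
≡ᵇ-comm zero    (suc n) = refl
≡ᵇ-comm (suc m) zero    = refl
≡ᵇ-comm (suc m) (suc n) = ≡ᵇ-comm m n

eqᶠ-suc : ∀ {n} (u v : Fin n) → eqᶠ (suc u) (suc v) ≡ eqᶠ u v
eqᶠ-suc u v = ⌊⌋-map′ (cong suc) suc-injective (u ≟ v)

eqᶠ-comm : ∀ {n} (u v : Fin n) → eqᶠ u v ≡ eqᶠ v u
eqᶠ-comm u v =
  trans (isYes≗does (u ≟ v)) (trans (does-⇔ (mk⇔ sym sym) (u ≟ v) (v ≟ u)) (sym (isYes≗does (v ≟ u))))

∑ : List A → (A → ℕ) → ℕ
∑ xs f = sum (map f xs)

infix 2 ∑
syntax ∑ xs (λ x → e) = ∑[ x ← xs ] e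

∑-cong : (xs : List A) {f g : A → ℕ} → (∀ x → f x ≡ g x) → ∑ xs f ≡ ∑ xs g
∑-cong xs f≗g = cong sum (map-cong f≗g xs)

∑-zero : (xs : List A) → (∑[ _ ← xs ] 0) ≡ 0
∑-zero []       = refl
∑-zero (_ ∷ xs) = ∑-zero xs

∑-const : (xs : List A) (c : ℕ) → (∑[ _ ← xs ] c) ≡ length xs * c
∑-const []       c = refl
∑-const (_ ∷ xs) c = cong (c +_) (∑-const xs c)

∑-distrib-+ : (xs : List A) (f g : A → ℕ) → (∑[ x ← xs ] f x + g x) ≡ ∑ xs f + ∑ xs g
∑-distrib-+ []       f g = refl
∑-distrib-+ (x ∷ xs) f g =
  trans (cong (f x + g x +_) (∑-distrib-+ xs f g)) (+-interchange (f x) (g x) (∑ xs f) (∑ xs g))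

∑-distribˡ-* : (xs : List A) (c : ℕ) (f : A → ℕ) → (∑[ x ← xs ] c * f x) ≡ c * ∑ xs f
∑-distribˡ-* []       c f = sym (*-zeroʳ c)
∑-distribˡ-* (x ∷ xs) c f =
  trans (cong (c * f x +_) (∑-distribˡ-* xs c f)) (sym (*-distribˡ-+ c (f x) (∑ xs f)))

∑-++ : (xs ys : List A) (f : A → ℕ) → ∑ (xs ++ ys) f ≡ ∑ xs f + ∑ ys f
∑-++ xs ys f = trans (cong sum (map-++ f xs ys)) (sum-++ (map f xs) (map f ys))

count≡∑𝟙 : (p : A → Bool) (xs : List A) → count p xs ≡ (∑[ x ← xs ] 𝟙 (p x))
count≡∑𝟙 p []       = refl
count≡∑𝟙 p (x ∷ xs) with p x
... | true  = cong suc (count≡∑𝟙 p xs)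
... | false = count≡∑𝟙 p xs

∑-cubic : (xs : List A) (p : A → ℕ) (a b c d : ℕ) →
  (∑[ x ← xs ] a + b * p x + c * p x ^ 2 + d * p x ^ 3)
    ≡ length xs * a + b * ∑ xs p + c * (∑[ x ← xs ] p x ^ 2) + d * (∑[ x ← xs ] p x ^ 3)
∑-cubic []       p a b c d = empty b c d
  where
  empty : ∀ b c d → 0 ≡ b * 0 + c * 0 + d * 0
  empty = solve-∀
∑-cubic (x ∷ xs) p a b c d = trans (cong (a + b * p x + c * p x ^ 2 + d * p x ^ 3 +_) (∑-cubic xs p a b c d))
                                   (cons a b c d (p x) (length xs) (∑ xs p) _ _)
  where
  -- The ring solver does not reflect Data.Nat._^_, so powers are spelled out as products.
  cons : ∀ a b c d q l s₁ s₂ s₃ →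
    a + b * q + c * (q * (q * 1)) + d * (q * (q * (q * 1))) + (l * a + b * s₁ + c * s₂ + d * s₃)
      ≡ (1 + l) * a + b * (q + s₁) + c * (q * (q * 1) + s₂) + d * (q * (q * (q * 1)) + s₃)
  cons = solve-∀

∑-map : (g : A → B) (xs : List A) (f : B → ℕ) → ∑ (map g xs) f ≡ ∑ xs (f ∘ g)
∑-map g xs f = cong sum (sym (map-∘ xs))

∑-cartesianProduct : (xs : List A) (ys : List B) (f : A × B → ℕ) →
  ∑ (cartesianProduct xs ys) f ≡ (∑[ x ← xs ] ∑[ y ← ys ] f (x , y))
∑-cartesianProduct []       ys f = refl
∑-cartesianProduct (x ∷ xs) ys f =
  trans (∑-++ (map (x ,_) ys) _ f) (cong₂ _+_ (∑-map (x ,_) ys f) (∑-cartesianProduct xs ys f))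

∑-comm : (xs : List A) (ys : List B) (f : A → B → ℕ) →
  (∑[ x ← xs ] ∑[ y ← ys ] f x y) ≡ (∑[ y ← ys ] ∑[ x ← xs ] f x y)
∑-comm []       ys f = sym (∑-zero ys)
∑-comm (x ∷ xs) ys f =
  trans (cong (∑ ys (f x) +_) (∑-comm xs ys f)) (sym (∑-distrib-+ ys (f x) (λ y → ∑[ x ← xs ] f x y)))

∑-mapMaybe : (g : A → Maybe B) (xs : List A) (f : B → ℕ) →
  ∑ (mapMaybe g xs) f ≡ (∑[ x ← xs ] maybe f 0 (g x))
∑-mapMaybe g []       f = refl
∑-mapMaybe g (x ∷ xs) f with g x
... | just y  = cong (f y +_) (∑-mapMaybe g xs f)
... | nothing = ∑-mapMaybe g xs f

∑-allFin-suc : ∀ n (f : Fin (suc n) → ℕ) → ∑ (allFin (suc n)) f ≡ f zero + (∑[ i ← allFin n ] f (suc i))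
∑-allFin-suc n f = cong (λ xs → f zero + sum xs) (trans (map-tabulate suc f) (sym (map-tabulate id (f ∘ suc))))

∑-allFin-toℕ : ∀ n (f : ℕ → ℕ) → (∑[ i ← allFin n ] f (toℕ i)) ≡ sum (applyUpTo f n)
∑-allFin-toℕ n f = cong sum (trans (map-tabulate id (f ∘ toℕ)) (tabulate-toℕ n f))
  where
  tabulate-toℕ : ∀ n (f : ℕ → ℕ) → tabulate (f ∘ toℕ {n}) ≡ applyUpTo f n
  tabulate-toℕ zero    f = refl
  tabulate-toℕ (suc n) f = cong (f 0 ∷_) (tabulate-toℕ n (f ∘ suc))

∑-δ : ∀ n (u : Fin n) (a : Fin n → ℕ) → (∑[ i ← allFin n ] 𝟙 (eqᶠ u i) * a i) ≡ a u
∑-δ (suc n) zero    a = begin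
    (∑[ i ← allFin (suc n) ] 𝟙 (eqᶠ zero i) * a i)   ≡⟨ ∑-allFin-suc n (λ i → 𝟙 (eqᶠ zero i) * a i) ⟩
    (a zero + 0) + (∑[ i ← allFin n ] 0)              ≡⟨ cong ((a zero + 0) +_) (∑-zero (allFin n)) ⟩
    (a zero + 0) + 0                                  ≡⟨ trans (+-identityʳ _) (+-identityʳ _) ⟩
    a zero                                            ∎
∑-δ (suc n) (suc u) a = begin
    (∑[ i ← allFin (suc n) ] 𝟙 (eqᶠ (suc u) i) * a i)   ≡⟨ ∑-allFin-suc n (λ i → 𝟙 (eqᶠ (suc u) i) * a i) ⟩
    (∑[ i ← allFin n ] 𝟙 (eqᶠ (suc u) (suc i)) * a (suc i))
      ≡⟨ ∑-cong (allFin n) (λ i → cong (λ b → 𝟙 b * a (suc i)) (eqᶠ-suc u i)) ⟩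
    (∑[ i ← allFin n ] 𝟙 (eqᶠ u i) * a (suc i))          ≡⟨ ∑-δ n u (a ∘ suc) ⟩
    a (suc u)                                            ∎

∑-δ′ : ∀ n (u : Fin n) (a : Fin n → ℕ) → (∑[ i ← allFin n ] 𝟙 (eqᶠ i u) * a i) ≡ a u
∑-δ′ n u a = trans (∑-cong (allFin n) (λ i → cong (λ b → 𝟙 b * a i) (eqᶠ-comm i u))) (∑-δ n u a)

∑-δ-∧ : ∀ n (u : Fin n) (b : Fin n → Bool) → (∑[ i ← allFin n ] 𝟙 (eqᶠ u i ∧ b i)) ≡ 𝟙 (b u)
∑-δ-∧ n u b = trans (∑-cong (allFin n) (λ i → 𝟙-∧ (eqᶠ u i) (b i))) (∑-δ n u (𝟙 ∘ b))

length-allFin : ∀ n → length (allFin n) ≡ n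
length-allFin n = length-tabulate id

module _ {n} (G : SimpleGraph n) where

  private
    pairs : List (Fin n × Fin n)
    pairs = cartesianProduct (allFin n) (allFin n)

  isEdge⇒≢ : ∀ {i j} → T (isEdge G (i , j)) → i ≢ j
  isEdge⇒≢ {i} ij refl = subst (λ b → T (b ∧ adj G i i)) (≥⇒<ᵇ≡false (≤-refl {toℕ i})) ij

  𝟙-incident : ∀ {i j} → T (isEdge G (i , j)) → ∀ u → 𝟙 (eqᶠ u i ∨ eqᶠ u j) ≡ 𝟙 (eqᶠ u i) + 𝟙 (eqᶠ u j)
  𝟙-incident {i} {j} ij u = 𝟙-∨ (eqᶠ u i) (eqᶠ u j) (λ ui uj →
    isEdge⇒≢ ij (trans (sym (toWitness {a? = u ≟ i} ui)) (toWitness {a? = u ≟ j} uj)))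

  isEdge-either : ∀ u j → 𝟙 (isEdge G (u , j)) + 𝟙 (isEdge G (j , u)) ≡ 𝟙 (adj G u j)
  isEdge-either u j with <-cmp (toℕ u) (toℕ j)
  ... | tri< u<j _ _ rewrite <⇒<ᵇ≡true u<j | ≥⇒<ᵇ≡false (<⇒≤ u<j) = +-identityʳ _
  ... | tri> _ _ j<u rewrite ≥⇒<ᵇ≡false (<⇒≤ j<u) | <⇒<ᵇ≡true j<u | SimpleGraph.sym G j u = refl
  ... | tri≈ _ u≡j _ with toℕ-injective u≡j
  ...   | refl rewrite irrefl G u | ∧-zeroʳ (toℕ u <ᵇ toℕ u) = refl

  ∑-edgeList : (f : Edge G → ℕ) (c : Fin n × Fin n → ℕ) → (∀ p t → f (p , t) ≡ c p) →
    ∑ (edgeList G) f ≡ (∑[ p ← pairs ] 𝟙 (isEdge G p) * c p)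
  ∑-edgeList f c f≡c =
    trans (∑-mapMaybe (λ p → Maybe.map (p ,_) (withProof (isEdge G p))) pairs f)
          (∑-cong pairs (λ p → guarded (isEdge G p) (p ,_) (f≡c p)))
    where
    guarded : ∀ {p} b (k : T b → Edge G) → (∀ t → f (k t) ≡ c p) →
      maybe f 0 (Maybe.map k (withProof b)) ≡ 𝟙 b * c p
    guarded true  k f∘k≡c = trans (f∘k≡c tt) (sym (+-identityʳ _))
    guarded false k f∘k≡c = refl

  length-edgeList : length (edgeList G) ≡ numEdges G
  length-edgeList = begin
    length (edgeList G)                       ≡⟨ sym (*-identityʳ _) ⟩
    length (edgeList G) * 1                   ≡⟨ sym (∑-const (edgeList G) 1) ⟩
    (∑[ _ ← edgeList G ] 1)                   ≡⟨ ∑-edgeList (λ _ → 1) (λ _ → 1) (λ _ _ → refl) ⟩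
    (∑[ p ← pairs ] 𝟙 (isEdge G p) * 1)       ≡⟨ ∑-cong pairs (λ p → *-identityʳ _) ⟩
    (∑[ p ← pairs ] 𝟙 (isEdge G p))           ≡⟨ sym (count≡∑𝟙 (isEdge G) pairs) ⟩
    numEdges G                                ∎

  ∑-incident≡deg : ∀ u → (∑[ e ← edgeList G ] 𝟙 (incident {G = G} u e)) ≡ deg G u
  ∑-incident≡deg u = begin
      (∑[ e ← edgeList G ] 𝟙 (incident {G = G} u e))
    ≡⟨ ∑-edgeList _ (λ (i , j) → 𝟙 (eqᶠ u i ∨ eqᶠ u j)) (λ _ _ → refl) ⟩
      (∑[ p ← pairs ] 𝟙 (isEdge G p) * 𝟙 (eqᶠ u (proj₁ p) ∨ eqᶠ u (proj₂ p)))
    ≡⟨ ∑-cartesianProduct (allFin n) (allFin n) _ ⟩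
      (∑[ i ← allFin n ] ∑[ j ← allFin n ] 𝟙 (isEdge G (i , j)) * 𝟙 (eqᶠ u i ∨ eqᶠ u j))
    ≡⟨ ∑-cong (allFin n) (λ i → ∑-cong (allFin n) (λ j → split i j)) ⟩
      (∑[ i ← allFin n ] ∑[ j ← allFin n ] 𝟙 (eqᶠ u i) * X i j + 𝟙 (eqᶠ u j) * X i j)
    ≡⟨ ∑-cong (allFin n) (λ i → ∑-distrib-+ (allFin n) _ _) ⟩
      (∑[ i ← allFin n ] (∑[ j ← allFin n ] 𝟙 (eqᶠ u i) * X i j) + (∑[ j ← allFin n ] 𝟙 (eqᶠ u j) * X i j))
    ≡⟨ ∑-distrib-+ (allFin n) _ _ ⟩
      (∑[ i ← allFin n ] ∑[ j ← allFin n ] 𝟙 (eqᶠ u i) * X i j) + (∑[ i ← allFin n ] ∑[ j ← allFin n ] 𝟙 (eqᶠ u j) * X i j)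
    ≡⟨ cong₂ _+_ outgoing incoming ⟩
      (∑[ j ← allFin n ] X u j) + (∑[ j ← allFin n ] X j u)
    ≡⟨ sym (∑-distrib-+ (allFin n) _ _) ⟩
      (∑[ j ← allFin n ] X u j + X j u)
    ≡⟨ ∑-cong (allFin n) (isEdge-either u) ⟩
      (∑[ j ← allFin n ] 𝟙 (adj G u j))
    ≡⟨ sym (count≡∑𝟙 (adj G u) (allFin n)) ⟩
      deg G u
    ∎
    where
    X : Fin n → Fin n → ℕ
    X i j = 𝟙 (isEdge G (i , j))
    split : ∀ i j → X i j * 𝟙 (eqᶠ u i ∨ eqᶠ u j) ≡ 𝟙 (eqᶠ u i) * X i j + 𝟙 (eqᶠ u j) * X i j
    split i j with isEdge G (i , j) in ij
    ... | false = sym (cong₂ _+_ (*-zeroʳ (𝟙 (eqᶠ u i))) (*-zeroʳ (𝟙 (eqᶠ u j))))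
    ... | true  = begin
        𝟙 (eqᶠ u i ∨ eqᶠ u j) + 0        ≡⟨ +-identityʳ _ ⟩
        𝟙 (eqᶠ u i ∨ eqᶠ u j)            ≡⟨ 𝟙-incident (subst T (sym ij) tt) u ⟩
        𝟙 (eqᶠ u i) + 𝟙 (eqᶠ u j)        ≡⟨ sym (cong₂ _+_ (*-identityʳ (𝟙 (eqᶠ u i))) (*-identityʳ (𝟙 (eqᶠ u j)))) ⟩
        𝟙 (eqᶠ u i) * 1 + 𝟙 (eqᶠ u j) * 1 ∎
    outgoing : (∑[ i ← allFin n ] ∑[ j ← allFin n ] 𝟙 (eqᶠ u i) * X i j) ≡ (∑[ j ← allFin n ] X u j)
    outgoing = trans (∑-cong (allFin n) (λ i → ∑-distribˡ-* (allFin n) (𝟙 (eqᶠ u i)) (X i)))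
                     (∑-δ n u (λ i → ∑ (allFin n) (X i)))
    incoming : (∑[ i ← allFin n ] ∑[ j ← allFin n ] 𝟙 (eqᶠ u j) * X i j) ≡ (∑[ i ← allFin n ] X i u)
    incoming = ∑-cong (allFin n) (λ i → ∑-δ n u (X i))

  ∑-incident≡2 : ∀ e → (∑[ u ← allFin n ] 𝟙 (incident {G = G} u e)) ≡ 2
  ∑-incident≡2 ((i , j) , ij) = begin
      (∑[ u ← allFin n ] 𝟙 (eqᶠ u i ∨ eqᶠ u j))
    ≡⟨ ∑-cong (allFin n) (𝟙-incident ij) ⟩
      (∑[ u ← allFin n ] 𝟙 (eqᶠ u i) + 𝟙 (eqᶠ u j))
    ≡⟨ ∑-distrib-+ (allFin n) _ _ ⟩
      (∑[ u ← allFin n ] 𝟙 (eqᶠ u i)) + (∑[ u ← allFin n ] 𝟙 (eqᶠ u j))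
    ≡⟨ cong₂ _+_ (single i) (single j) ⟩
      2
    ∎
    where
    single : ∀ k → (∑[ u ← allFin n ] 𝟙 (eqᶠ u k)) ≡ 1
    single k = trans (∑-cong (allFin n) (λ u → sym (*-identityʳ _))) (∑-δ′ n k (λ _ → 1))

  handshake : ∑ (allFin n) (deg G) ≡ 2 * numEdges G
  handshake = begin
    ∑ (allFin n) (deg G)                                                ≡⟨ ∑-cong (allFin n) (sym ∘ ∑-incident≡deg) ⟩
    (∑[ u ← allFin n ] ∑[ e ← edgeList G ] 𝟙 (incident {G = G} u e))   ≡⟨ ∑-comm (allFin n) (edgeList G) _ ⟩
    (∑[ e ← edgeList G ] ∑[ u ← allFin n ] 𝟙 (incident {G = G} u e))   ≡⟨ ∑-cong (edgeList G) ∑-incident≡2 ⟩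
    (∑[ _ ← edgeList G ] 2)                                             ≡⟨ ∑-const (edgeList G) 2 ⟩
    length (edgeList G) * 2                                             ≡⟨ cong (_* 2) length-edgeList ⟩
    numEdges G * 2                                                      ≡⟨ *-comm (numEdges G) 2 ⟩
    2 * numEdges G                                                      ∎

module _ {n m} (G : SimpleGraph n) (H : SimpleGraph m) where

  ∑-verts-SSum : (f : SVtx G × Fin m → ℕ) →
    ∑ (verts (SSum G H)) f
      ≡ (∑[ u ← allFin n ] ∑[ v ← allFin m ] f (inj₁ u , v)) + (∑[ e ← edgeList G ] ∑[ v ← allFin m ] f (inj₂ e , v))
  ∑-verts-SSum f = begin
      ∑ (verts (SSum G H)) f
    ≡⟨ ∑-cartesianProduct (map inj₁ (allFin n) ++ map inj₂ (edgeList G)) (allFin m) f ⟩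
      (∑[ x ← map inj₁ (allFin n) ++ map inj₂ (edgeList G) ] ∑[ v ← allFin m ] f (x , v))
    ≡⟨ ∑-++ (map inj₁ (allFin n)) (map inj₂ (edgeList G)) _ ⟩
      (∑[ x ← map inj₁ (allFin n) ] ∑[ v ← allFin m ] f (x , v)) + (∑[ x ← map inj₂ (edgeList G) ] ∑[ v ← allFin m ] f (x , v))
    ≡⟨ cong₂ _+_ (∑-map inj₁ (allFin n) _) (∑-map inj₂ (edgeList G) _) ⟩
      (∑[ u ← allFin n ] ∑[ v ← allFin m ] f (inj₁ u , v)) + (∑[ e ← edgeList G ] ∑[ v ← allFin m ] f (inj₂ e , v))
    ∎

  degL-SSum : ∀ w → degL (SSum G H) w
    ≡ (∑[ u′ ← allFin n ] ∑[ v′ ← allFin m ] 𝟙 (ladj (SSum G H) w (inj₁ u′ , v′)))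
      + (∑[ e ← edgeList G ] ∑[ v′ ← allFin m ] 𝟙 (ladj (SSum G H) w (inj₂ e , v′)))
  degL-SSum w = trans (count≡∑𝟙 (ladj (SSum G H) w) (verts (SSum G H))) (∑-verts-SSum (𝟙 ∘ ladj (SSum G H) w))

  degL-SSum-vertex : ∀ u v → degL (SSum G H) (inj₁ u , v) ≡ deg H v + deg G u
  degL-SSum-vertex u v = trans (degL-SSum (inj₁ u , v)) (cong₂ _+_ fibre subdivision)
    where
    fibre : (∑[ u′ ← allFin n ] ∑[ v′ ← allFin m ] 𝟙 ((eqᶠ u u′ ∧ adj H v v′) ∨ (eqᶠ v v′ ∧ false))) ≡ deg H v
    fibre = begin
        (∑[ u′ ← allFin n ] ∑[ v′ ← allFin m ] 𝟙 ((eqᶠ u u′ ∧ adj H v v′) ∨ (eqᶠ v v′ ∧ false)))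
      ≡⟨ ∑-cong (allFin n) (λ u′ → ∑-cong (allFin m) (λ v′ → cong 𝟙 (noSubdivisionEdge u′ v′))) ⟩
        (∑[ u′ ← allFin n ] ∑[ v′ ← allFin m ] 𝟙 (eqᶠ u u′ ∧ adj H v v′))
      ≡⟨ ∑-cong (allFin n) (λ u′ → trans (∑-cong (allFin m) (λ v′ → 𝟙-∧ (eqᶠ u u′) (adj H v v′)))
                                          (∑-distribˡ-* (allFin m) (𝟙 (eqᶠ u u′)) _)) ⟩
        (∑[ u′ ← allFin n ] 𝟙 (eqᶠ u u′) * (∑[ v′ ← allFin m ] 𝟙 (adj H v v′)))
      ≡⟨ ∑-δ n u _ ⟩
        (∑[ v′ ← allFin m ] 𝟙 (adj H v v′))
      ≡⟨ sym (count≡∑𝟙 (adj H v) (allFin m)) ⟩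
        deg H v
      ∎
      where
      noSubdivisionEdge : ∀ u′ v′ → ((eqᶠ u u′ ∧ adj H v v′) ∨ (eqᶠ v v′ ∧ false)) ≡ (eqᶠ u u′ ∧ adj H v v′)
      noSubdivisionEdge u′ v′ rewrite ∧-zeroʳ (eqᶠ v v′) = ∨-identityʳ _
    subdivision : (∑[ e ← edgeList G ] ∑[ v′ ← allFin m ] 𝟙 (eqᶠ v v′ ∧ incident {G = G} u e)) ≡ deg G u
    subdivision = trans (∑-cong (edgeList G) (λ e → ∑-δ-∧ m v (λ _ → incident {G = G} u e))) (∑-incident≡deg G u)

  degL-SSum-edge : ∀ e v → degL (SSum G H) (inj₂ e , v) ≡ 2
  degL-SSum-edge e v = trans (degL-SSum (inj₂ e , v)) (cong₂ _+_ ends noEdgeEdge)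
    where
    ends : (∑[ u′ ← allFin n ] ∑[ v′ ← allFin m ] 𝟙 (eqᶠ v v′ ∧ incident {G = G} u′ e)) ≡ 2
    ends = trans (∑-cong (allFin n) (λ u′ → ∑-δ-∧ m v (λ _ → incident {G = G} u′ e))) (∑-incident≡2 G e)
    noEdgeEdge : (∑[ e′ ← edgeList G ] ∑[ v′ ← allFin m ] 𝟙 (eqᶠ v v′ ∧ false)) ≡ 0
    noEdgeEdge = trans (∑-cong (edgeList G) (λ _ → ∑-δ-∧ m v (λ _ → false))) (∑-zero (edgeList G))

  FL-SSum : FL (SSum G H) ≡ (∑[ u ← allFin n ] ∑[ v ← allFin m ] (deg H v + deg G u) ^ 3) + numEdges G * (m * 8)
  FL-SSum = trans (∑-verts-SSum _) (cong₂ _+_ vertexPart edgePart)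
    where
    vertexPart : (∑[ u ← allFin n ] ∑[ v ← allFin m ] degL (SSum G H) (inj₁ u , v) ^ 3)
               ≡ (∑[ u ← allFin n ] ∑[ v ← allFin m ] (deg H v + deg G u) ^ 3)
    vertexPart = ∑-cong (allFin n) (λ u → ∑-cong (allFin m) (λ v → cong (_^ 3) (degL-SSum-vertex u v)))
    edgePart : (∑[ e ← edgeList G ] ∑[ v ← allFin m ] degL (SSum G H) (inj₂ e , v) ^ 3) ≡ numEdges G * (m * 8)
    edgePart = begin
        (∑[ e ← edgeList G ] ∑[ v ← allFin m ] degL (SSum G H) (inj₂ e , v) ^ 3)
      ≡⟨ ∑-cong (edgeList G) (λ e → ∑-cong (allFin m) (λ v → cong (_^ 3) (degL-SSum-edge e v))) ⟩
        (∑[ e ← edgeList G ] ∑[ v ← allFin m ] 8)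
      ≡⟨ ∑-cong (edgeList G) (λ _ → trans (∑-const (allFin m) 8) (cong (_* 8) (length-allFin m))) ⟩
        (∑[ e ← edgeList G ] m * 8)
      ≡⟨ trans (∑-const (edgeList G) (m * 8)) (cong (_* (m * 8)) (length-edgeList G)) ⟩
        numEdges G * (m * 8)
      ∎

∑-shifted-cubes : ∀ {m} (H : SimpleGraph m) p →
  (∑[ v ← allFin m ] (deg H v + p) ^ 3) ≡ F H + 3 * M₁ H * p + 6 * numEdges H * p ^ 2 + m * p ^ 3
∑-shifted-cubes {m} H p = begin
    (∑[ v ← allFin m ] (deg H v + p) ^ 3)
  ≡⟨ ∑-cong (allFin m) (λ v → binomial (deg H v) p) ⟩
    (∑[ v ← allFin m ] p ^ 3 + 3 * p ^ 2 * deg H v + 3 * p * deg H v ^ 2 + 1 * deg H v ^ 3)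
  ≡⟨ ∑-cubic (allFin m) (deg H) (p ^ 3) (3 * p ^ 2) (3 * p) 1 ⟩
    length (allFin m) * p ^ 3 + 3 * p ^ 2 * ∑ (allFin m) (deg H) + 3 * p * M₁ H + 1 * F H
  ≡⟨ cong₂ (λ l s → l * p ^ 3 + 3 * p ^ 2 * s + 3 * p * M₁ H + 1 * F H) (length-allFin m) (handshake H) ⟩
    m * p ^ 3 + 3 * p ^ 2 * (2 * numEdges H) + 3 * p * M₁ H + 1 * F H
  ≡⟨ regroup m p (numEdges H) (M₁ H) (F H) ⟩
    F H + 3 * M₁ H * p + 6 * numEdges H * p ^ 2 + m * p ^ 3
  ∎
  where
  binomial : ∀ d p → (d + p) * ((d + p) * ((d + p) * 1))
             ≡ p * (p * (p * 1)) + 3 * (p * (p * 1)) * d + 3 * p * (d * (d * 1)) + 1 * (d * (d * (d * 1)))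
  binomial = solve-∀
  regroup : ∀ m p e s f → m * (p * (p * (p * 1))) + 3 * (p * (p * 1)) * (2 * e) + 3 * p * s + 1 * f
                            ≡ f + 3 * s * p + 6 * e * (p * (p * 1)) + m * (p * (p * (p * 1)))
  regroup = solve-∀

F-SSum : ∀ {n m} (G : SimpleGraph n) (H : SimpleGraph m) →
  FL (SSum G H) ≡ n * F H + 6 * numEdges G * M₁ H + 6 * M₁ G * numEdges H + m * F G + 8 * numEdges G * m
F-SSum {n} {m} G H = begin
    FL (SSum G H)
  ≡⟨ FL-SSum G H ⟩
    (∑[ u ← allFin n ] ∑[ v ← allFin m ] (deg H v + deg G u) ^ 3) + numEdges G * (m * 8)
  ≡⟨ cong (_+ numEdges G * (m * 8)) (∑-cong (allFin n) (λ u → ∑-shifted-cubes H (deg G u))) ⟩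
    (∑[ u ← allFin n ] F H + 3 * M₁ H * deg G u + 6 * numEdges H * deg G u ^ 2 + m * deg G u ^ 3) + numEdges G * (m * 8)
  ≡⟨ cong (_+ numEdges G * (m * 8)) (∑-cubic (allFin n) (deg G) (F H) (3 * M₁ H) (6 * numEdges H) m) ⟩
    length (allFin n) * F H + 3 * M₁ H * ∑ (allFin n) (deg G) + 6 * numEdges H * M₁ G + m * F G + numEdges G * (m * 8)
  ≡⟨ cong₂ (λ l s → l * F H + 3 * M₁ H * s + 6 * numEdges H * M₁ G + m * F G + numEdges G * (m * 8))
           (length-allFin n) (handshake G) ⟩
    n * F H + 3 * M₁ H * (2 * numEdges G) + 6 * numEdges H * M₁ G + m * F G + numEdges G * (m * 8)
  ≡⟨ regroup n (F H) (M₁ H) (numEdges G) (numEdges H) (M₁ G) m (F G) ⟩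
    n * F H + 6 * numEdges G * M₁ H + 6 * M₁ G * numEdges H + m * F G + 8 * numEdges G * m
  ∎
  where
  regroup : ∀ n f s e e′ s′ m f′ →
    n * f + 3 * s * (2 * e) + 6 * e′ * s′ + m * f′ + e * (m * 8) ≡ n * f + 6 * e * s + 6 * s′ * e′ + m * f′ + 8 * e * m
  regroup = solve-∀

sum-applyUpTo-suc : ∀ r (h : ℕ → ℕ) → sum (applyUpTo h (suc r)) ≡ sum (applyUpTo h r) + h r
sum-applyUpTo-suc r h =
  trans (cong sum (sym (applyUpTo-∷ʳ h r)))
        (trans (sum-++ (applyUpTo h r) [ h r ]) (cong (sum (applyUpTo h r) +_) (+-identityʳ (h r))))

sum-applyUpTo-const : ∀ r (h : ℕ → ℕ) c → (∀ k → k < r → h k ≡ c) → sum (applyUpTo h r) ≡ r * c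
sum-applyUpTo-const zero    h c h≡c = refl
sum-applyUpTo-const (suc r) h c h≡c =
  cong₂ _+_ (h≡c 0 (s≤s z≤n)) (sum-applyUpTo-const r (h ∘ suc) c (λ k k<r → h≡c (suc k) (s≤s k<r)))

sum-applyUpTo-≡ᵇ : ∀ n t → sum (applyUpTo (λ k → 𝟙 (k ≡ᵇ t)) n) ≡ 𝟙 (t <ᵇ n)
sum-applyUpTo-≡ᵇ zero    t       = refl
sum-applyUpTo-≡ᵇ (suc n) zero    = cong suc (trans (sum-applyUpTo-const n _ 0 (λ _ _ → refl)) (*-zeroʳ n))
sum-applyUpTo-≡ᵇ (suc n) (suc t) = sum-applyUpTo-≡ᵇ n t

deg-Path : ∀ n (u : Fin n) → deg (Path n) u ≡ 𝟙 (suc (toℕ u) <ᵇ n) + 𝟙 (0 <ᵇ toℕ u)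
deg-Path n u = begin
    deg (Path n) u
  ≡⟨ count≡∑𝟙 _ (allFin n) ⟩
    (∑[ j ← allFin n ] 𝟙 ((suc (toℕ u) ≡ᵇ toℕ j) ∨ (suc (toℕ j) ≡ᵇ toℕ u)))
  ≡⟨ ∑-cong (allFin n) (λ j → 𝟙-∨ _ _ (notBoth (toℕ j))) ⟩
    (∑[ j ← allFin n ] 𝟙 (suc (toℕ u) ≡ᵇ toℕ j) + 𝟙 (suc (toℕ j) ≡ᵇ toℕ u))
  ≡⟨ ∑-distrib-+ (allFin n) _ _ ⟩
    (∑[ j ← allFin n ] 𝟙 (suc (toℕ u) ≡ᵇ toℕ j)) + (∑[ j ← allFin n ] 𝟙 (suc (toℕ j) ≡ᵇ toℕ u))
  ≡⟨ cong₂ _+_ (trans (∑-cong (allFin n) (λ j → cong 𝟙 (≡ᵇ-comm (suc (toℕ u)) (toℕ j)))) (∑-allFin-toℕ n _))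
               (∑-allFin-toℕ n _) ⟩
    sum (applyUpTo (λ k → 𝟙 (k ≡ᵇ suc (toℕ u))) n) + sum (applyUpTo (λ k → 𝟙 (suc k ≡ᵇ toℕ u)) n)
  ≡⟨ cong₂ _+_ (sum-applyUpTo-≡ᵇ n (suc (toℕ u))) (left (toℕ u) (toℕ<n u)) ⟩
    𝟙 (suc (toℕ u) <ᵇ n) + 𝟙 (0 <ᵇ toℕ u)
  ∎
  where
  notBoth : ∀ j → T (suc (toℕ u) ≡ᵇ j) → T (suc j ≡ᵇ toℕ u) → ⊥
  notBoth j u+1≡j j+1≡u = m≢1+n+m (toℕ u) {1} (sym (trans (cong suc (≡ᵇ⇒≡ (suc (toℕ u)) j u+1≡j)) (≡ᵇ⇒≡ (suc j) (toℕ u) j+1≡u)))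
  left : ∀ t → t < n → sum (applyUpTo (λ k → 𝟙 (suc k ≡ᵇ t)) n) ≡ 𝟙 (0 <ᵇ t)
  left zero    _     = trans (sum-applyUpTo-const n _ 0 (λ _ _ → refl)) (*-zeroʳ n)
  left (suc t) t+1<n = trans (sum-applyUpTo-≡ᵇ n t) (cong 𝟙 (<⇒<ᵇ≡true (<⇒≤ t+1<n)))

∑-Path : ∀ r (g : ℕ → ℕ) → (∑[ u ← allFin (2 + r) ] g (deg (Path (2 + r)) u)) ≡ 2 * g 1 + r * g 2
∑-Path r g = begin
    (∑[ u ← allFin (2 + r) ] g (deg (Path (2 + r)) u))
  ≡⟨ ∑-cong (allFin (2 + r)) (λ u → cong g (deg-Path (2 + r) u)) ⟩
    (∑[ u ← allFin (2 + r) ] g (d (toℕ u)))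
  ≡⟨ ∑-allFin-toℕ (2 + r) (g ∘ d) ⟩
    g 1 + sum (applyUpTo (g ∘ d ∘ suc) (suc r))
  ≡⟨ cong (g 1 +_) (sum-applyUpTo-suc r (g ∘ d ∘ suc)) ⟩
    g 1 + (sum (applyUpTo (g ∘ d ∘ suc) r) + g (d (suc r)))
  ≡⟨ cong₂ (λ a b → g 1 + (a + g b)) (sum-applyUpTo-const r (g ∘ d ∘ suc) (g 2) interior) endpoint ⟩
    g 1 + (r * g 2 + g 1)
  ≡⟨ regroup (g 1) (g 2) r ⟩
    2 * g 1 + r * g 2
  ∎
  where
  d : ℕ → ℕ
  d k = 𝟙 (suc k <ᵇ 2 + r) + 𝟙 (0 <ᵇ k)
  interior : ∀ k → k < r → g (d (suc k)) ≡ g 2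
  interior k k<r rewrite <⇒<ᵇ≡true k<r = refl
  endpoint : d (suc r) ≡ 1
  endpoint rewrite ≥⇒<ᵇ≡false (≤-refl {r}) = refl
  regroup : ∀ a b r → a + (r * b + a) ≡ 2 * a + r * b
  regroup = solve-∀

numEdges-Path : ∀ r → numEdges (Path (2 + r)) ≡ 1 + r
numEdges-Path r = *-cancelˡ-≡ _ _ 2 (trans (sym (handshake (Path (2 + r)))) (trans (∑-Path r id) (double r)))
  where
  double : ∀ r → 2 * 1 + r * 2 ≡ 2 * (1 + r)
  double = solve-∀

M₁-Path : ∀ r → M₁ (Path (2 + r)) ≡ 2 + r * 4
M₁-Path r = ∑-Path r (_^ 2)

F-Path : ∀ r → F (Path (2 + r)) ≡ 2 + r * 8
F-Path r = ∑-Path r (_^ 3)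

closed-form-Path : ∀ r f s e m →
  (2 + r) * f + 6 * (1 + r) * s + 6 * (2 + r * 4) * e + m * (2 + r * 8) + 8 * (1 + r) * m
    ≡ (2 + r) * f + 6 * (2 + r ∸ 1) * s + 12 * (2 * (2 + r) ∸ 3) * e + 2 * (8 * (2 + r) ∸ 11) * m
closed-form-Path r f s e m = begin
    (2 + r) * f + 6 * (1 + r) * s + 6 * (2 + r * 4) * e + m * (2 + r * 8) + 8 * (1 + r) * m
  ≡⟨ regroup r f s e m ⟩
    (2 + r) * f + 6 * (1 + r) * s + 12 * (1 + 2 * r) * e + 2 * (5 + 8 * r) * m
  ≡⟨ cong₂ (λ a b → (2 + r) * f + 6 * (1 + r) * s + 12 * a * e + 2 * b * m)
           (∸-by {b = 3} (twice r)) (∸-by {b = 11} (eightfold r)) ⟨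
    (2 + r) * f + 6 * (2 + r ∸ 1) * s + 12 * (2 * (2 + r) ∸ 3) * e + 2 * (8 * (2 + r) ∸ 11) * m
  ∎
  where
  regroup : ∀ r f s e m →
    (2 + r) * f + 6 * (1 + r) * s + 6 * (2 + r * 4) * e + m * (2 + r * 8) + 8 * (1 + r) * m
      ≡ (2 + r) * f + 6 * (1 + r) * s + 12 * (1 + 2 * r) * e + 2 * (5 + 8 * r) * m
  regroup = solve-∀
  twice : ∀ r → 2 * (2 + r) ≡ 3 + (1 + 2 * r)
  twice = solve-∀
  eightfold : ∀ r → 8 * (2 + r) ≡ 11 + (5 + 8 * r)
  eightfold = solve-∀
  ∸-by : ∀ {a b c} → a ≡ b + c → a ∸ b ≡ c
  ∸-by {b = b} {c} refl = m+n∸m≡n b c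

corollary2 : (n : ℕ) → 2 ≤ n → ∀ {m} (H : SimpleGraph m) → Connected H →
    FL (SSum (Path n) H)
      ≡ n * F H + 6 * (n ∸ 1) * M₁ H + 12 * (2 * n ∸ 3) * numEdges H + 2 * (8 * n ∸ 11) * m
corollary2 (suc (suc r)) (s≤s (s≤s z≤n)) {m} H _ = begin
    FL (SSum P H)
  ≡⟨ F-SSum P H ⟩
    n * F H + 6 * numEdges P * M₁ H + 6 * M₁ P * numEdges H + m * F P + 8 * numEdges P * m
  ≡⟨ cong₂ (λ e s → n * F H + 6 * e * M₁ H + 6 * s * numEdges H + m * F P + 8 * e * m)
           (numEdges-Path r) (M₁-Path r) ⟩
    n * F H + 6 * (1 + r) * M₁ H + 6 * (2 + r * 4) * numEdges H + m * F P + 8 * (1 + r) * m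
  ≡⟨ cong (λ f → n * F H + 6 * (1 + r) * M₁ H + 6 * (2 + r * 4) * numEdges H + m * f + 8 * (1 + r) * m)
          (F-Path r) ⟩
    n * F H + 6 * (1 + r) * M₁ H + 6 * (2 + r * 4) * numEdges H + m * (2 + r * 8) + 8 * (1 + r) * m
  ≡⟨ closed-form-Path r (F H) (M₁ H) (numEdges H) m ⟩
    n * F H + 6 * (n ∸ 1) * M₁ H + 12 * (2 * n ∸ 3) * numEdges H + 2 * (8 * n ∸ 11) * m
  ∎
  where
  n = 2 + r
  P = Path n
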